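{- Let $\sigma$ be a cycle-alternating permutation of $[2n]$. Then for every $i\in[2n]$: if $i$ is a cycle valley of $\sigma$, then $\mathrm{ucross}(i,\sigma)+\mathrm{unest}(i,\sigma)\equiv i-1 \pmod 2$; and if $i$ is a cycle peak of $\sigma$, then $\mathrm{lcross}(i,\sigma)+\mathrm{lnest}(i,\sigma)\equiv i \pmod 2$.
   Context: For a permutation $\sigma$ of $[N]$, an index $i$ is a cycle peak if $\sigma^{ -1}(i)<i>\sigma(i)$, a cycle valley if $\sigma^{ -1}(i)>i<\sigma(i)$, a cycle double rise if $\sigma^{ -1}(i)<i<\sigma(i)$, a cycle double fall if $\sigma^{ -1}(i)>i>\sigma(i)$, a fixed point if $\sigma(i)=i$. $\sigma$ is cycle-alternating if it has no cycle double rises, cycle double falls or fixed points. The index-refined crossing and nesting statistics are: $\mathrm{ucross}(j,\sigma)=\#\{(i,k,l): i<j<k<l,\ k=\sigma(i),\ l=\sigma(j)\}$; $\mathrm{unest}(j,\sigma)=\#\{(i,k,l): i<j<k<l,\ k=\sigma(j),\ l=\sigma(i)\}$; $\mathrm{lcross}(k,\sigma)=\#\{(i,j,l): i<j<k<l,\ i=\sigma(k),\ j=\sigma(l)\}$; $\mathrm{lnest}(k,\sigma)=\#\{(i,j,l): i<j<k<l,\ i=\sigma(l),\ j=\sigma(k)\}$. -}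

module Defs where

open import Data.Nat using (ℕ; suc)
open import Data.Fin using (Fin; toℕ; _<_; _<?_; _≟_)
open import Data.Fin.Permutation using (Permutation′; _⟨$⟩ʳ_; _⟨$⟩ˡ_)
open import Data.List using (List; length; filter; cartesianProduct)
open import Data.Fin.Base using () renaming (_<_ to _<ᶠ_)
open import Data.List using (allFin)
open import Data.Product using (_×_; _,_)
open import Data.Sum using (_⊎_)
open import Relation.Binary.PropositionalEquality using (_≡_)
open import Relation.Nullary using (¬_)
open import Relation.Nullary.Decidable using (_×-dec_)

-- Permutations of [N] are permutations of Fin N; the element i : Fin N stands for
-- the integer label i = toℕ i + 1 ∈ [N].  Order on Fin is the order of labels.
label : {N : ℕ} → Fin N → ℕ
label i = suc (toℕ i)

module _ {N : ℕ} (σ : Permutation′ N) where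

  σ⁺ : Fin N → Fin N
  σ⁺ i = σ ⟨$⟩ʳ i

  σ⁻ : Fin N → Fin N
  σ⁻ i = σ ⟨$⟩ˡ i

  IsCyclePeak : Fin N → Set
  IsCyclePeak i = (σ⁻ i < i) × (σ⁺ i < i)

  IsCycleValley : Fin N → Set
  IsCycleValley i = (i < σ⁻ i) × (i < σ⁺ i)

  IsCycleDoubleRise : Fin N → Set
  IsCycleDoubleRise i = (σ⁻ i < i) × (i < σ⁺ i)

  IsCycleDoubleFall : Fin N → Set
  IsCycleDoubleFall i = (i < σ⁻ i) × (σ⁺ i < i)

  IsFixedPoint : Fin N → Set
  IsFixedPoint i = σ⁺ i ≡ i

  IsCycleAlternating : Set
  IsCycleAlternating = (i : Fin N) →
    ¬ IsCycleDoubleRise i × ¬ IsCycleDoubleFall i × ¬ IsFixedPoint i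

  triples : List (Fin N × Fin N × Fin N)
  triples = cartesianProduct (allFin N) (cartesianProduct (allFin N) (allFin N))

  ucross : Fin N → ℕ
  ucross j = length (filter
    (λ { (i , k , l) → (i <? j) ×-dec (j <? k) ×-dec (k <? l)
                        ×-dec (k ≟ σ⁺ i) ×-dec (l ≟ σ⁺ j) })
    triples)

  unest : Fin N → ℕ
  unest j = length (filter
    (λ { (i , k , l) → (i <? j) ×-dec (j <? k) ×-dec (k <? l)
                        ×-dec (k ≟ σ⁺ j) ×-dec (l ≟ σ⁺ i) })
    triples)

  lcross : Fin N → ℕ
  lcross k = length (filter
    (λ { (i , j , l) → (i <? j) ×-dec (j <? k) ×-dec (k <? l)
                        ×-dec (i ≟ σ⁺ k) ×-dec (j ≟ σ⁺ l) })
    triples)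

  lnest : Fin N → ℕ
  lnest k = length (filter
    (λ { (i , j , l) → (i <? j) ×-dec (j <? k) ×-dec (k <? l)
                        ×-dec (i ≟ σ⁺ l) ×-dec (j ≟ σ⁺ k) })
    triples)

-- In a cycle-alternating permutation σ maps valleys to peaks and peaks to valleys.
-- Hence, among the i < j with σ(i) < j, the peaks and the valleys are equinumerous
-- (σ carries the valleys onto the peaks below j), so their number is 2·#{peaks < j}.
-- For a valley j, the remaining i < j, those with σ(i) > j, are exactly the ones
-- counted by ucross(j) + unest(j), according as σ(i) < σ(j) or σ(i) > σ(j); thus
-- ucross(j) + unest(j) = j − 1 − 2·#{peaks < j}.  Dually, for a peak k,
-- lcross(k) + lnest(k) = 2n − k − 2·#{valleys > k}.
module Submission where

open import Defs
open import Level using (Level)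
open import Data.Nat using (ℕ; zero; suc; _+_; _*_; _∸_; _%_; z<s; s<s; s<s⁻¹)
import Data.Nat.Properties as ℕ
open import Data.Nat.DivMod using (%-remove-+ˡ)
open import Data.Nat.Divisibility using (m∣m*n)
open import Data.Nat.Tactic.RingSolver using (solve-∀)
open import Data.Fin using (Fin; zero; suc; toℕ; _<_; _<?_)
import Data.Fin.Properties as Fin
open import Data.Fin.Permutation using (Permutation′; _⟨$⟩ʳ_; _⟨$⟩ˡ_; inverseˡ; inverseʳ)
open import Data.List using (List; []; _∷_; _++_; length; filter; map; tabulate; cartesianProduct; allFin)
open import Data.List.Properties using (filter-++; length-++)
open import Data.Product using (_×_; _,_; proj₁; proj₂)
open import Data.Sum using (_⊎_; inj₁; inj₂)
open import Function using (_∘_; id)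
open import Relation.Binary.Definitions using (tri<; tri≈; tri>)
open import Relation.Binary.PropositionalEquality
  using (_≡_; _≢_; refl; sym; trans; cong; cong₂; subst; module ≡-Reasoning)
open import Relation.Nullary using (¬_; Dec; yes; no; ¬?; contradiction)
open import Relation.Nullary.Decidable using (_×-dec_)
open import Relation.Unary using (Pred; Decidable; _≐_)
open import Relation.Unary.Properties using (_∩?_; ∁?)
open import Algebra.Properties.CommutativeMonoid.Sum ℕ.+-0-commutativeMonoid
  using (sum; sum-cong-≗; ∑-comm; ∑-distrib-+; sum-permute)

open ≡-Reasoning

private
  variable
    a b p q : Level
    A B : Set a
    N : ℕ

𝟙 : {P : Set p} → Dec P → ℕ
𝟙 (yes _) = 1
𝟙 (no _)  = 0

𝟙-no : {P : Set p} → ¬ P → (P? : Dec P) → 𝟙 P? ≡ 0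
𝟙-no ¬p (yes p) = contradiction p ¬p
𝟙-no ¬p (no _)  = refl

𝟙-cong : {P : Set p} {Q : Set q} → (P → Q) → (Q → P) →
         (P? : Dec P) (Q? : Dec Q) → 𝟙 P? ≡ 𝟙 Q?
𝟙-cong f g (yes p) (yes q) = refl
𝟙-cong f g (yes p) (no ¬q) = contradiction (f p) ¬q
𝟙-cong f g (no ¬p) (yes q) = contradiction (g q) ¬p
𝟙-cong f g (no ¬p) (no ¬q) = refl

𝟙-partition : {P : Set p} {Q : Set q} (P? : Dec P) (Q? : Dec Q) →
              𝟙 P? ≡ 𝟙 (P? ×-dec Q?) + 𝟙 (P? ×-dec ¬? Q?)
𝟙-partition (yes _) (yes _) = refl
𝟙-partition (yes _) (no _)  = refl
𝟙-partition (no _)  (yes _) = refl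
𝟙-partition (no _)  (no _)  = refl

-- Opaque so that unification recovers the decision procedure from count P?,
-- instead of unfolding count to a fold over Fin N.
opaque
  count : {P : Pred (Fin N) p} → Decidable P → ℕ
  count P? = sum (λ i → 𝟙 (P? i))

opaque
  unfolding count

  count-cong : {P : Pred (Fin N) p} {Q : Pred (Fin N) q} {P? : Decidable P} {Q? : Decidable Q} →
               P ≐ Q → count P? ≡ count Q?
  count-cong {P? = P?} {Q?} (P⊆Q , Q⊆P) = sum-cong-≗ λ i → 𝟙-cong P⊆Q Q⊆P (P? i) (Q? i)

  count-partition : {P : Pred (Fin N) p} {Q : Pred (Fin N) q} (P? : Decidable P) (Q? : Decidable Q) →
                    count P? ≡ count (P? ∩? Q?) + count (P? ∩? ∁? Q?)
  count-partition P? Q? =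
    trans (sum-cong-≗ λ i → 𝟙-partition (P? i) (Q? i))
          (∑-distrib-+ (λ i → 𝟙 (P? i ×-dec Q? i)) (λ i → 𝟙 (P? i ×-dec ¬? (Q? i))))

  count-∘-permutation : {P : Pred (Fin N) p} (π : Permutation′ N) (P? : Decidable P) →
                        count (λ i → P? (π ⟨$⟩ʳ i)) ≡ count P?
  count-∘-permutation π P? = sym (sum-permute (λ i → 𝟙 (P? i)) π)

  count-suc : {P : Pred (Fin (suc N)) p} (P? : Decidable P) →
              count P? ≡ 𝟙 (P? zero) + count (P? ∘ suc)
  count-suc P? = refl

  count-none : {P : Pred (Fin N) p} (P? : Decidable P) → (∀ i → ¬ P i) → count P? ≡ 0
  count-none {N = zero}  P? ¬P = refl
  count-none {N = suc N} P? ¬P =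
    cong₂ _+_ (𝟙-no (¬P zero) (P? zero)) (count-none (P? ∘ suc) (¬P ∘ suc))

  count-all : {P : Pred (Fin N) p} (P? : Decidable P) → (∀ i → P i) → count P? ≡ N
  count-all {N = zero}  P? all = refl
  count-all {N = suc N} P? all with P? zero
  ... | yes _  = cong suc (count-all (P? ∘ suc) (all ∘ suc))
  ... | no ¬p0 = contradiction (all zero) ¬p0

  count-unique : {P : Pred (Fin N) p} {c : Fin N} (P? : Decidable P) →
                 (∀ {i} → P i → i ≡ c) → count P? ≡ 𝟙 (P? c)
  count-unique {N = suc N} {c = zero} P? unique =
    trans (cong (𝟙 (P? zero) +_) (count-none (P? ∘ suc) λ i p → contradiction (unique p) λ ()))
          (ℕ.+-identityʳ _)
  count-unique {N = suc N} {c = suc c} P? unique =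
    cong₂ _+_ (𝟙-no (λ p → contradiction (unique p) λ ()) (P? zero))
              (count-unique (P? ∘ suc) (Fin.suc-injective ∘ unique))

  count-unique₂ : {P : Fin N → Fin N → Set p} {x₀ y₀ : Fin N} (P? : ∀ x → Decidable (P x)) →
                  (∀ {x y} → P x y → x ≡ x₀ × y ≡ y₀) → sum (λ x → count (P? x)) ≡ 𝟙 (P? x₀ y₀)
  count-unique₂ {x₀ = x₀} {y₀} P? unique = begin
    sum (λ x → count (P? x))  ≡⟨ sum-cong-≗ (λ x → count-unique (P? x) (proj₂ ∘ unique)) ⟩
    count (λ x → P? x y₀)     ≡⟨ count-unique (λ x → P? x y₀) (proj₁ ∘ unique) ⟩
    𝟙 (P? x₀ y₀)              ∎

count-< : ∀ {N} (j : Fin N) → count (λ (i : Fin N) → i <? j) ≡ toℕ j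
count-< {suc N} zero    = count-none _ λ _ ()
count-< {suc N} (suc j) =
  trans (count-suc _) (cong suc (trans (count-cong (s<s⁻¹ , s<s)) (count-< j)))

count-> : ∀ {N} (k : Fin N) → suc (toℕ k + count (λ (l : Fin N) → k <? l)) ≡ N
count-> {suc N} zero    = cong suc (trans (count-suc _) (count-all _ λ _ → z<s))
count-> {suc N} (suc k) = cong suc (trans
  (cong (λ c → suc (toℕ k + c)) (trans (count-suc _) (count-cong (s<s⁻¹ , s<s))))
  (count-> k))

count-split-< : {P : Pred (Fin N) p} (P? : Decidable P) (f : Fin N → Fin N) (c : Fin N) →
                (∀ {i} → P i → f i ≢ c) →
                count P? ≡ count (λ i → P? i ×-dec (f i <? c)) + count (λ i → P? i ×-dec (c <? f i))
count-split-< {P = P} P? f c f≢c = begin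
  count P?
    ≡⟨ count-partition P? (λ i → f i <? c) ⟩
  count (λ i → P? i ×-dec (f i <? c)) + count (λ i → P? i ×-dec ¬? (f i <? c))
    ≡⟨ cong (count (λ i → P? i ×-dec (f i <? c)) +_) (count-cong (above , not-below)) ⟩
  count (λ i → P? i ×-dec (f i <? c)) + count (λ i → P? i ×-dec (c <? f i)) ∎
  where
  above : ∀ {i} → P i × ¬ f i < c → P i × c < f i
  above (pi , fi≮c) = pi , Fin.≤∧≢⇒< (ℕ.≮⇒≥ fi≮c) (f≢c pi ∘ sym)
  not-below : ∀ {i} → P i × c < f i → P i × ¬ f i < c
  not-below (pi , c<fi) = pi , Fin.<-asym c<fi

length-filter-map : {P : Pred B p} (P? : Decidable P) (f : A → B) (xs : List A) →
                    length (filter P? (map f xs)) ≡ length (filter (λ x → P? (f x)) xs)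
length-filter-map P? f []       = refl
length-filter-map P? f (x ∷ xs) with P? (f x)
... | yes _ = cong suc (length-filter-map P? f xs)
... | no _  = length-filter-map P? f xs

length-filter-cartesianProduct :
  ∀ {N} {P : Pred (A × B) p} (P? : Decidable P) (f : Fin N → A) (ys : List B) →
  length (filter P? (cartesianProduct (tabulate f) ys))
    ≡ sum (λ i → length (filter (λ y → P? (f i , y)) ys))
length-filter-cartesianProduct {N = zero}  P? f ys = refl
length-filter-cartesianProduct {N = suc N} P? f ys = begin
  length (filter P? (map (f zero ,_) ys ++ rest))
    ≡⟨ cong length (filter-++ P? (map (f zero ,_) ys) rest) ⟩
  length (filter P? (map (f zero ,_) ys) ++ filter P? rest)
    ≡⟨ length-++ (filter P? (map (f zero ,_) ys)) ⟩
  length (filter P? (map (f zero ,_) ys)) + length (filter P? rest)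
    ≡⟨ cong₂ _+_ (length-filter-map P? (f zero ,_) ys)
                 (length-filter-cartesianProduct P? (f ∘ suc) ys) ⟩
  sum (λ i → length (filter (λ y → P? (f i , y)) ys))
    ∎
  where rest = cartesianProduct (tabulate (f ∘ suc)) ys

opaque
  unfolding count

  length-filter-tabulate : ∀ {N} {P : Pred A p} (P? : Decidable P) (f : Fin N → A) →
                           length (filter P? (tabulate f)) ≡ count (λ i → P? (f i))
  length-filter-tabulate {N = zero}  P? f = refl
  length-filter-tabulate {N = suc N} P? f with P? (f zero)
  ... | yes _ = cong suc (length-filter-tabulate P? (f ∘ suc))
  ... | no _  = length-filter-tabulate P? (f ∘ suc)

  length-filter-triples :
    ∀ {N} {P : Pred (Fin N × Fin N × Fin N) p} (P? : Decidable P) →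
    length (filter P? (cartesianProduct (allFin N) (cartesianProduct (allFin N) (allFin N))))
      ≡ sum (λ a → sum (λ b → count (λ c → P? (a , b , c))))
  length-filter-triples P? =
    trans (length-filter-cartesianProduct P? id _) (sum-cong-≗ λ a →
      trans (length-filter-cartesianProduct (λ bc → P? (a , bc)) id _) (sum-cong-≗ λ b →
        length-filter-tabulate (λ c → P? (a , b , c)) id))

  length-filter-graphˡ :
    ∀ {N} {P : Pred (Fin N × Fin N × Fin N) p} (P? : Decidable P) (f g : Fin N → Fin N) →
    (∀ {a b c} → P (a , b , c) → b ≡ f a × c ≡ g a) →
    length (filter P? (cartesianProduct (allFin N) (cartesianProduct (allFin N) (allFin N))))
      ≡ count (λ a → P? (a , f a , g a))
  length-filter-graphˡ P? f g graph = trans (length-filter-triples P?)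
    (sum-cong-≗ λ a → count-unique₂ (λ b c → P? (a , b , c)) graph)

  length-filter-graphʳ :
    ∀ {N} {P : Pred (Fin N × Fin N × Fin N) p} (P? : Decidable P) (f g : Fin N → Fin N) →
    (∀ {a b c} → P (a , b , c) → a ≡ f c × b ≡ g c) →
    length (filter P? (cartesianProduct (allFin N) (cartesianProduct (allFin N) (allFin N))))
      ≡ count (λ c → P? (f c , g c , c))
  length-filter-graphʳ P? f g graph = begin
    _ ≡⟨ length-filter-triples P? ⟩
    sum (λ a → sum (λ b → sum (λ c → 𝟙 (P? (a , b , c)))))
      ≡⟨ sum-cong-≗ (λ a → ∑-comm (λ b c → 𝟙 (P? (a , b , c)))) ⟩
    sum (λ a → sum (λ c → sum (λ b → 𝟙 (P? (a , b , c)))))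
      ≡⟨ ∑-comm (λ a c → sum (λ b → 𝟙 (P? (a , b , c)))) ⟩
    sum (λ c → sum (λ a → sum (λ b → 𝟙 (P? (a , b , c)))))
      ≡⟨ sum-cong-≗ (λ c → count-unique₂ (λ a b → P? (a , b , c)) graph) ⟩
    count (λ c → P? (f c , g c , c)) ∎

count-∩-preimage≡2*count-∩ :
  ∀ {N} {S : Pred (Fin N) p} {T : Pred (Fin N) q}
  (π : Permutation′ N) (S? : Decidable S) (T? : Decidable T) →
  (∀ {i} → T i → ¬ T (π ⟨$⟩ʳ i)) → (∀ {i} → ¬ T i → T (π ⟨$⟩ʳ i)) →
  (∀ {i} → S i → T i → S (π ⟨$⟩ʳ i)) → (∀ {i} → S (π ⟨$⟩ʳ i) → T (π ⟨$⟩ʳ i) → S i) →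
  count (λ i → S? i ×-dec S? (π ⟨$⟩ʳ i)) ≡ 2 * count (S? ∩? T?)
count-∩-preimage≡2*count-∩ {S = S} {T} π S? T? T⇒¬Tπ ¬T⇒Tπ S∩T⇒Sπ Sπ∩Tπ⇒S = begin
  count (λ i → S? i ×-dec S? (π ⟨$⟩ʳ i))
    ≡⟨ count-partition (λ i → S? i ×-dec S? (π ⟨$⟩ʳ i)) T? ⟩
  count (λ i → (S? i ×-dec S? (π ⟨$⟩ʳ i)) ×-dec T? i)
    + count (λ i → (S? i ×-dec S? (π ⟨$⟩ʳ i)) ×-dec ¬? (T? i))
    ≡⟨ cong₂ _+_ (count-cong (marked , marked⁻¹)) (count-cong (unmarked , unmarked⁻¹)) ⟩
  count (S? ∩? T?) + count (λ i → (S? ∩? T?) (π ⟨$⟩ʳ i))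
    ≡⟨ cong (count (S? ∩? T?) +_) (count-∘-permutation π (S? ∩? T?)) ⟩
  count (S? ∩? T?) + count (S? ∩? T?)
    ≡⟨ cong (count (S? ∩? T?) +_) (sym (ℕ.+-identityʳ _)) ⟩
  2 * count (S? ∩? T?) ∎
  where
  marked : ∀ {i} → (S i × S (π ⟨$⟩ʳ i)) × T i → S i × T i
  marked ((s , _) , t) = s , t
  marked⁻¹ : ∀ {i} → S i × T i → (S i × S (π ⟨$⟩ʳ i)) × T i
  marked⁻¹ (s , t) = (s , S∩T⇒Sπ s t) , t
  unmarked : ∀ {i} → (S i × S (π ⟨$⟩ʳ i)) × ¬ T i → S (π ⟨$⟩ʳ i) × T (π ⟨$⟩ʳ i)
  unmarked ((_ , sπ) , ¬t) = sπ , ¬T⇒Tπ ¬t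
  unmarked⁻¹ : ∀ {i} → S (π ⟨$⟩ʳ i) × T (π ⟨$⟩ʳ i) → (S i × S (π ⟨$⟩ʳ i)) × ¬ T i
  unmarked⁻¹ (sπ , tπ) = (Sπ∩Tπ⇒S sπ tπ , sπ) , λ t → T⇒¬Tπ t tπ

2*m+n≡o⇒n%2≡o%2 : ∀ m n {o} → 2 * m + n ≡ o → n % 2 ≡ o % 2
2*m+n≡o⇒n%2≡o%2 m n eq = trans (sym (%-remove-+ˡ n (m∣m*n m))) (cong (_% 2) eq)

m+[n+2*o]≡2*r⇒n%2≡m%2 : ∀ m n o r → m + (n + 2 * o) ≡ 2 * r → n % 2 ≡ m % 2
m+[n+2*o]≡2*r⇒n%2≡m%2 m n o r eq = begin
  n % 2          ≡⟨ 2*m+n≡o⇒n%2≡o%2 (o + m) n (trans (regroup m n o) (cong (_+ m) eq)) ⟩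
  (2 * r + m) % 2 ≡⟨ 2*m+n≡o⇒n%2≡o%2 r m refl ⟨
  m % 2          ∎
  where
  regroup : ∀ m n o → 2 * (o + m) + n ≡ m + (n + 2 * o) + m
  regroup = solve-∀

module _ {N : ℕ} (σ : Permutation′ N) where

  cyclePeak? : Decidable (IsCyclePeak σ)
  cyclePeak? i = (σ⁻ σ i <? i) ×-dec (σ⁺ σ i <? i)

  cycleValley? : Decidable (IsCycleValley σ)
  cycleValley? i = (i <? σ⁻ σ i) ×-dec (i <? σ⁺ σ i)

  peaksBelow : Fin N → ℕ
  peaksBelow j = count (λ i → (i <? j) ×-dec cyclePeak? i)

  valleysAbove : Fin N → ℕ
  valleysAbove k = count (λ l → (k <? l) ×-dec cycleValley? l)

  peak⇒¬valley : ∀ {i} → IsCyclePeak σ i → ¬ IsCycleValley σ i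
  peak⇒¬valley (σ⁻i<i , _) (i<σ⁻i , _) = Fin.<-asym σ⁻i<i i<σ⁻i

  σ⁺≡⇒≡σ⁻ : ∀ {i j} → σ⁺ σ i ≡ j → i ≡ σ⁻ σ j
  σ⁺≡⇒≡σ⁻ σi≡j = trans (sym (inverseˡ σ)) (cong (σ⁻ σ) σi≡j)

  σ⁺-injective : ∀ {i j} → σ⁺ σ i ≡ σ⁺ σ j → i ≡ j
  σ⁺-injective σi≡σj = trans (σ⁺≡⇒≡σ⁻ σi≡σj) (inverseˡ σ)

  ucross≡count : ∀ j → ucross σ j ≡
    count (λ i → ((i <? j) ×-dec (j <? σ⁺ σ i)) ×-dec (σ⁺ σ i <? σ⁺ σ j))
  ucross≡count j = trans
    (length-filter-graphˡ _ (σ⁺ σ) (λ _ → σ⁺ σ j) λ (_ , _ , _ , k≡σi , l≡σj) → k≡σi , l≡σj)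
    (count-cong ( (λ (i<j , j<σi , σi<σj , _) → (i<j , j<σi) , σi<σj)
                , (λ ((i<j , j<σi) , σi<σj) → i<j , j<σi , σi<σj , refl , refl)))

  unest≡count : ∀ {j} → j < σ⁺ σ j → unest σ j ≡
    count (λ i → ((i <? j) ×-dec (j <? σ⁺ σ i)) ×-dec (σ⁺ σ j <? σ⁺ σ i))
  unest≡count {j} j<σj = trans
    (length-filter-graphˡ _ (λ _ → σ⁺ σ j) (σ⁺ σ) λ (_ , _ , _ , k≡σj , l≡σi) → k≡σj , l≡σi)
    (count-cong ( (λ (i<j , _ , σj<σi , _) → (i<j , Fin.<-trans j<σj σj<σi) , σj<σi)
                , (λ ((i<j , _) , σj<σi) → i<j , j<σj , σj<σi , refl , refl)))

  lcross≡count : ∀ k → lcross σ k ≡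
    count (λ l → ((k <? l) ×-dec (σ⁺ σ l <? k)) ×-dec (σ⁺ σ k <? σ⁺ σ l))
  lcross≡count k = trans
    (length-filter-graphʳ _ (λ _ → σ⁺ σ k) (σ⁺ σ) λ (_ , _ , _ , i≡σk , j≡σl) → i≡σk , j≡σl)
    (count-cong ( (λ (σk<σl , σl<k , k<l , _) → (k<l , σl<k) , σk<σl)
                , (λ ((k<l , σl<k) , σk<σl) → σk<σl , σl<k , k<l , refl , refl)))

  lnest≡count : ∀ {k} → σ⁺ σ k < k → lnest σ k ≡
    count (λ l → ((k <? l) ×-dec (σ⁺ σ l <? k)) ×-dec (σ⁺ σ l <? σ⁺ σ k))
  lnest≡count {k} σk<k = trans
    (length-filter-graphʳ _ (σ⁺ σ) (λ _ → σ⁺ σ k) λ (_ , _ , _ , i≡σl , j≡σk) → i≡σl , j≡σk)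
    (count-cong ( (λ (σl<σk , _ , k<l , _) → (k<l , Fin.<-trans σl<σk σk<k) , σl<σk)
                , (λ ((k<l , _) , σl<σk) → σl<σk , σk<k , k<l , refl , refl)))

  ucross+unest≡count : ∀ {j} → IsCycleValley σ j →
    ucross σ j + unest σ j ≡ count (λ i → (i <? j) ×-dec (j <? σ⁺ σ i))
  ucross+unest≡count {j} (_ , j<σj) = begin
    ucross σ j + unest σ j
      ≡⟨ cong₂ _+_ (ucross≡count j) (unest≡count j<σj) ⟩
    count (λ i → ((i <? j) ×-dec (j <? σ⁺ σ i)) ×-dec (σ⁺ σ i <? σ⁺ σ j))
      + count (λ i → ((i <? j) ×-dec (j <? σ⁺ σ i)) ×-dec (σ⁺ σ j <? σ⁺ σ i))
      ≡⟨ count-split-< (λ i → (i <? j) ×-dec (j <? σ⁺ σ i)) (σ⁺ σ) (σ⁺ σ j)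
                       (λ (i<j , _) → Fin.<⇒≢ i<j ∘ σ⁺-injective) ⟨
    count (λ i → (i <? j) ×-dec (j <? σ⁺ σ i)) ∎

  lcross+lnest≡count : ∀ {k} → IsCyclePeak σ k →
    lcross σ k + lnest σ k ≡ count (λ l → (k <? l) ×-dec (σ⁺ σ l <? k))
  lcross+lnest≡count {k} (_ , σk<k) = begin
    lcross σ k + lnest σ k
      ≡⟨ ℕ.+-comm (lcross σ k) (lnest σ k) ⟩
    lnest σ k + lcross σ k
      ≡⟨ cong₂ _+_ (lnest≡count σk<k) (lcross≡count k) ⟩
    count (λ l → ((k <? l) ×-dec (σ⁺ σ l <? k)) ×-dec (σ⁺ σ l <? σ⁺ σ k))
      + count (λ l → ((k <? l) ×-dec (σ⁺ σ l <? k)) ×-dec (σ⁺ σ k <? σ⁺ σ l))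
      ≡⟨ count-split-< (λ l → (k <? l) ×-dec (σ⁺ σ l <? k)) (σ⁺ σ) (σ⁺ σ k)
                       (λ (k<l , _) → Fin.<⇒≢ k<l ∘ sym ∘ σ⁺-injective) ⟨
    count (λ l → (k <? l) ×-dec (σ⁺ σ l <? k)) ∎

  module _ (alt : IsCycleAlternating σ) where

    peak⊎valley : ∀ i → IsCyclePeak σ i ⊎ IsCycleValley σ i
    peak⊎valley i with alt i | Fin.<-cmp (σ⁻ σ i) i | Fin.<-cmp (σ⁺ σ i) i
    ... | _ , _ , ¬fixed | _                 | tri≈ _ σi≡i _ = contradiction σi≡i ¬fixed
    ... | _ , _ , ¬fixed | tri≈ _ σ⁻i≡i _   | _             =
      contradiction (trans (cong (σ⁺ σ) (sym σ⁻i≡i)) (inverseʳ σ)) ¬fixed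
    ... | _              | tri< σ⁻i<i _ _   | tri< σi<i _ _ = inj₁ (σ⁻i<i , σi<i)
    ... | ¬rise , _      | tri< σ⁻i<i _ _   | tri> _ _ i<σi = contradiction (σ⁻i<i , i<σi) ¬rise
    ... | _ , ¬fall , _  | tri> _ _ i<σ⁻i   | tri< σi<i _ _ = contradiction (i<σ⁻i , σi<i) ¬fall
    ... | _              | tri> _ _ i<σ⁻i   | tri> _ _ i<σi = inj₂ (i<σ⁻i , i<σi)

    ¬peak⇒valley : ∀ {i} → ¬ IsCyclePeak σ i → IsCycleValley σ i
    ¬peak⇒valley {i} ¬peak with peak⊎valley i
    ... | inj₁ peak   = contradiction peak ¬peak
    ... | inj₂ valley = valley

    ¬valley⇒peak : ∀ {i} → ¬ IsCycleValley σ i → IsCyclePeak σ i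
    ¬valley⇒peak {i} ¬valley with peak⊎valley i
    ... | inj₁ peak   = peak
    ... | inj₂ valley = contradiction valley ¬valley

    valley⇒peak-σ⁺ : ∀ {i} → IsCycleValley σ i → IsCyclePeak σ (σ⁺ σ i)
    valley⇒peak-σ⁺ {i} (_ , i<σi) = ¬valley⇒peak λ (σi<σ⁻σi , _) →
      Fin.<-asym i<σi (subst (σ⁺ σ i <_) (inverseˡ σ) σi<σ⁻σi)

    peak⇒valley-σ⁺ : ∀ {i} → IsCyclePeak σ i → IsCycleValley σ (σ⁺ σ i)
    peak⇒valley-σ⁺ {i} (_ , σi<i) = ¬peak⇒valley λ (σ⁻σi<σi , _) →
      Fin.<-asym σi<i (subst (_< σ⁺ σ i) (inverseˡ σ) σ⁻σi<σi)

    2*peaksBelow+ucross+unest≡toℕ : ∀ {j} → IsCycleValley σ j →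
      2 * peaksBelow j + (ucross σ j + unest σ j) ≡ toℕ j
    2*peaksBelow+ucross+unest≡toℕ {j} valley@(j<σ⁻j , _) = begin
      2 * peaksBelow j + (ucross σ j + unest σ j)
        ≡⟨ cong₂ _+_ (sym peaks-twice) (ucross+unest≡count valley) ⟩
      count (λ i → (i <? j) ×-dec (σ⁺ σ i <? j)) + count (λ i → (i <? j) ×-dec (j <? σ⁺ σ i))
        ≡⟨ count-split-< (λ (i : Fin N) → i <? j) (σ⁺ σ) j σi≢j ⟨
      count (λ (i : Fin N) → i <? j)
        ≡⟨ count-< j ⟩
      toℕ j ∎
      where
      σi≢j : ∀ {i} → i < j → σ⁺ σ i ≢ j
      σi≢j i<j σi≡j = Fin.<-asym i<j (subst (j <_) (sym (σ⁺≡⇒≡σ⁻ σi≡j)) j<σ⁻j)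

      peaks-twice : count (λ i → (i <? j) ×-dec (σ⁺ σ i <? j)) ≡ 2 * peaksBelow j
      peaks-twice = count-∩-preimage≡2*count-∩ σ (λ (i : Fin N) → i <? j) cyclePeak?
        (λ peak peak-σ⁺ → peak⇒¬valley peak-σ⁺ (peak⇒valley-σ⁺ peak))
        (valley⇒peak-σ⁺ ∘ ¬peak⇒valley)
        (λ i<j (_ , σi<i) → Fin.<-trans σi<i i<j)
        (λ σi<j (σ⁻σi<σi , _) → Fin.<-trans (subst (_< _) (inverseˡ σ) σ⁻σi<σi) σi<j)

    label+lcross+lnest+2*valleysAbove≡N : ∀ {k} → IsCyclePeak σ k →
      label k + (lcross σ k + lnest σ k + 2 * valleysAbove k) ≡ N
    label+lcross+lnest+2*valleysAbove≡N {k} peak@(σ⁻k<k , _) = begin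
      label k + (lcross σ k + lnest σ k + 2 * valleysAbove k)
        ≡⟨ cong (label k +_) (cong₂ _+_ (lcross+lnest≡count peak) (sym valleys-twice)) ⟩
      label k + (count (λ l → (k <? l) ×-dec (σ⁺ σ l <? k)) + count (λ l → (k <? l) ×-dec (k <? σ⁺ σ l)))
        ≡⟨ cong (label k +_) (count-split-< (λ (l : Fin N) → k <? l) (σ⁺ σ) k σl≢k) ⟨
      label k + count (λ (l : Fin N) → k <? l)
        ≡⟨ count-> k ⟩
      N ∎
      where
      σl≢k : ∀ {l} → k < l → σ⁺ σ l ≢ k
      σl≢k k<l σl≡k = Fin.<-asym k<l (subst (_< k) (sym (σ⁺≡⇒≡σ⁻ σl≡k)) σ⁻k<k)

      valleys-twice : count (λ l → (k <? l) ×-dec (k <? σ⁺ σ l)) ≡ 2 * valleysAbove k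
      valleys-twice = count-∩-preimage≡2*count-∩ σ (λ (l : Fin N) → k <? l) cycleValley?
        (λ valley valley-σ⁺ → peak⇒¬valley (valley⇒peak-σ⁺ valley) valley-σ⁺)
        (peak⇒valley-σ⁺ ∘ ¬valley⇒peak)
        (λ k<l (_ , l<σl) → Fin.<-trans k<l l<σl)
        (λ k<σl (σl<σ⁻σl , _) → Fin.<-trans k<σl (subst (_ <_) (inverseˡ σ) σl<σ⁻σl))

lemma4p2 : (n : ℕ) (σ : Permutation′ (2 * n)) → IsCycleAlternating σ →
    (i : Fin (2 * n)) →
      (IsCycleValley σ i → (ucross σ i + unest σ i) % 2 ≡ (label i ∸ 1) % 2)
      × (IsCyclePeak σ i → (lcross σ i + lnest σ i) % 2 ≡ label i % 2)
lemma4p2 n σ alt i =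
    (λ valley → 2*m+n≡o⇒n%2≡o%2 (peaksBelow σ i) (ucross σ i + unest σ i)
                  (2*peaksBelow+ucross+unest≡toℕ σ alt valley))
  , (λ peak → m+[n+2*o]≡2*r⇒n%2≡m%2 (label i) (lcross σ i + lnest σ i) (valleysAbove σ i) n
                (label+lcross+lnest+2*valleysAbove≡N σ alt peak))
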